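{- In the base model, let $\pi^*=\max\{\pi(x,y): x\in\{0,1\}^n,y\in\{0,1\}^m\}$. Let $\pi^p$ be the optimal value of the same problem for the modified instance in which all $q_j$ ($j\in\mathbf M$) are replaced by $0$, and $\pi^q$ the optimal value for the modified instance in which all $p_i$ ($i\in\mathbf N$) are replaced by $0$ (all other data unchanged). Let $(x^{\mathrm{ARO}},y^{\mathrm{ARO}})$ be an optimal solution of the first modified instance if $\pi^p\ge\pi^q$, and an optimal solution of the second modified instance otherwise. Then $\pi(x^{\mathrm{ARO}},y^{\mathrm{ARO}})\ge 0.5\,\pi^*$, where $\pi$ is the revenue function of the original instance.
   Context: Base model. Let $n,m$ be positive integers, $\mathbf N=\{1,\dots,n\}$, $\mathbf M=\{1,\dots,m\}$, $\mathbf N_+=\mathbf N\cup\{0\}$, $\mathbf M_+=\mathbf M\cup\{0\}$. Prices $p_i\ge 0$ ($i\in\mathbf N$), $q_j\ge 0$ ($j\in\mathbf M$), $p_0=q_0=0$. Preference weights $u_{ij}\ge 0$ for $(i,j)\in\mathbf N_+\times\mathbf M_+$, with $u_{00}=1$. For an assortment $(x,y)\in\{0,1\}^n\times\{0,1\}^m$, set $x_0=y_0=1$ and $$\pi(x,y)=\frac{\sum_{i\in\mathbf N_+,j\in\mathbf M_+}u_{ij}x_iy_j(p_i+q_j)}{\sum_{i\in\mathbf N_+,j\in\mathbf M_+}u_{ij}x_iy_j}.$$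
   Formalization: The prices $p_i$, $q_j$ and the preference weights $u_{ij}$ are rational. -}

module Defs where

open import Data.Nat using (ℕ; zero; suc)
open import Data.Fin using (Fin; zero; suc)
open import Data.Bool using (Bool; true; false)
open import Data.Rational using (ℚ; 0ℚ; 1ℚ; _+_; _*_; _÷_; _≤_; ≢-nonZero)
open import Data.Rational.Properties using (_≟_)
open import Relation.Nullary using (yes; no)

sumFin : ∀ {k} → (Fin k → ℚ) → ℚ
sumFin {zero} f = 0ℚ
sumFin {suc k} f = f zero + sumFin (λ i → f (suc i))

-- division, with the (irrelevant here) convention a / 0 = 0
-- (the denominator of π is always ≥ u₀₀ = 1 under the hypotheses)
_/?_ : ℚ → ℚ → ℚ
a /? b with b ≟ 0ℚ
... | yes _ = 0ℚ
... | no b≢0 = _÷_ a b {{≢-nonZero b≢0}}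

[_] : Bool → ℚ
[ true ] = 1ℚ
[ false ] = 0ℚ

-- extend a vector over N (resp. M) by index 0 (the no-purchase option):
-- Fin (suc k) with zero ↦ index 0 and suc i ↦ index i+1.
ext : ∀ {A : Set} {k} → A → (Fin k → A) → Fin (suc k) → A
ext a v zero = a
ext a v (suc i) = v i

-- revenue function π(x,y) of the instance (p, q, u);
-- u : Fin (suc n) → Fin (suc m) → ℚ is indexed by N₊ × M₊, with index 0 = zero
revenue : ∀ {n m} → (Fin n → ℚ) → (Fin m → ℚ) → (Fin (suc n) → Fin (suc m) → ℚ)
        → (Fin n → Bool) → (Fin m → Bool) → ℚ
revenue {n} {m} p q u x y =
  sumFin (λ i → sumFin (λ j →
     u i j * [ ext true x i ] * [ ext true y j ] * (ext 0ℚ p i + ext 0ℚ q j)))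
  /? sumFin (λ i → sumFin (λ j → u i j * [ ext true x i ] * [ ext true y j ]))

IsOptimalValue : ∀ {n m} → ((Fin n → Bool) → (Fin m → Bool) → ℚ) → ℚ → Set
IsOptimalValue {n} {m} f v =
  Σ (Fin n → Bool) (λ x → Σ (Fin m → Bool) (λ y → f x y ≡ v))
  × (∀ x y → f x y ≤ v)
  where open import Data.Product using (Σ; _×_)
        open import Relation.Binary.PropositionalEquality using (_≡_)

IsOptimalSolution : ∀ {n m} → ((Fin n → Bool) → (Fin m → Bool) → ℚ)
                  → (Fin n → Bool) → (Fin m → Bool) → Set
IsOptimalSolution f x y = ∀ x' y' → f x' y' ≤ f x y

zeroPrice : ∀ {k} → Fin k → ℚ
zeroPrice _ = 0ℚ

{-# OPTIONS --safe #-}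
-- Both numerator and denominator of π are sums over the same weights u_ij x_i y_j, and the
-- denominator does not involve prices; so π(x,y) splits as πᵖ(x,y) + πᵠ(x,y), the revenues of
-- the two modified instances. Hence π* ≤ πp + πq ≤ 2 max(πp, πq). The ARO assortment attains
-- max(πp, πq) in its modified instance, and since both parts are nonnegative its original
-- revenue dominates that part.
module Submission where

open import Defs
open import Data.Nat using (ℕ; suc)
open import Data.Fin using (Fin; zero)
open import Data.Bool using (Bool)
open import Data.Rational using (ℚ; 0ℚ; 1ℚ; ½; _*_; _≤_)
open import Relation.Binary.PropositionalEquality using (_≡_)
open import Relation.Nullary using (¬_)

open import Data.Fin using (suc)
open import Data.Bool using (true; false)
open import Data.Rational using (_+_; 1/_; NonZero; Positive; ≢-nonZero; nonNegative)
open import Data.Rational.Properties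
open import Algebra.Properties.CommutativeMonoid.Sum +-0-commutativeMonoid
  using (sum; sum-cong-≗; ∑-distrib-+)
open import Data.Product using (_×_; _,_; uncurry)
open import Function using (_∘_)
open import Relation.Binary.PropositionalEquality
  using (refl; sym; trans; cong; cong₂; module ≡-Reasoning)
open import Relation.Nullary using (Dec; yes; no)

0≤+ : ∀ {a b} → 0ℚ ≤ a → 0ℚ ≤ b → 0ℚ ≤ a + b
0≤+ {a} {b} 0≤a 0≤b = nonNegative⁻¹ (a + b)
  {{nonNeg+nonNeg⇒nonNeg a {{nonNegative 0≤a}} b {{nonNegative 0≤b}}}}

0≤* : ∀ {a b} → 0ℚ ≤ a → 0ℚ ≤ b → 0ℚ ≤ a * b
0≤* {a} {b} 0≤a 0≤b = nonNegative⁻¹ (a * b)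
  {{nonNeg*nonNeg⇒nonNeg a {{nonNegative 0≤a}} b {{nonNegative 0≤b}}}}

p≤p+q : ∀ {p q} → 0ℚ ≤ q → p ≤ p + q
p≤p+q {p} 0≤q = ≤-trans (≤-reflexive (sym (+-identityʳ p))) (+-monoʳ-≤ p 0≤q)

q≤p+q : ∀ {p q} → 0ℚ ≤ p → q ≤ p + q
q≤p+q {p} {q} 0≤p = ≤-trans (p≤p+q 0≤p) (≤-reflexive (+-comm q p))

½*-≤ : ∀ {s t} → s ≤ t + t → ½ * s ≤ t
½*-≤ {s} {t} s≤t+t = ≤-trans (*-monoˡ-≤-nonNeg ½ s≤t+t) (≤-reflexive ½*[t+t]≡t)
  where
  open ≡-Reasoning
  ½*[t+t]≡t : ½ * (t + t) ≡ t
  ½*[t+t]≡t = begin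
    ½ * (t + t)   ≡⟨ *-distribˡ-+ ½ t t ⟩
    ½ * t + ½ * t ≡⟨ *-distribʳ-+ t ½ ½ ⟨
    (½ + ½) * t   ≡⟨ *-identityˡ t ⟩
    t             ∎

sumFin≡sum : ∀ {k} (f : Fin k → ℚ) → sumFin f ≡ sum f
sumFin≡sum {ℕ.zero} f = refl
sumFin≡sum {suc k} f = cong (f zero +_) (sumFin≡sum (f ∘ suc))

sumFin-split : ∀ {k} {f : Fin k → ℚ} (g h : Fin k → ℚ) → (∀ i → f i ≡ g i + h i) →
               sumFin f ≡ sumFin g + sumFin h
sumFin-split {f = f} g h f≡g+h = begin
  sumFin f                   ≡⟨ sumFin≡sum f ⟩
  sum f                      ≡⟨ sum-cong-≗ f≡g+h ⟩
  sum (λ i → g i + h i)      ≡⟨ ∑-distrib-+ g h ⟩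
  sum g + sum h              ≡⟨ cong₂ _+_ (sumFin≡sum g) (sumFin≡sum h) ⟨
  sumFin g + sumFin h        ∎
  where open ≡-Reasoning

sumFin-nonNeg : ∀ {k} {f : Fin k → ℚ} → (∀ i → 0ℚ ≤ f i) → 0ℚ ≤ sumFin f
sumFin-nonNeg {ℕ.zero} 0≤f = ≤-refl
sumFin-nonNeg {suc k} 0≤f = 0≤+ (0≤f zero) (sumFin-nonNeg (0≤f ∘ suc))

/?-distribʳ-+ : ∀ a b d → (a + b) /? d ≡ a /? d + b /? d
/?-distribʳ-+ a b d with d ≟ 0ℚ
... | yes _ = refl
... | no _  = *-distribʳ-+ _ a b

/?-nonNeg : ∀ {a b} → 0ℚ ≤ a → 0ℚ ≤ b → 0ℚ ≤ a /? b
/?-nonNeg {a} {b} 0≤a 0≤b with b ≟ 0ℚ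
... | yes _  = ≤-refl
... | no b≢0 = 0≤* 0≤a (nonNegative⁻¹ (1/ b) {{pos⇒nonNeg (1/ b)}})
  where
  instance
    b≢0ℚ : NonZero b
    b≢0ℚ = ≢-nonZero b≢0
    b>0 : Positive b
    b>0 = nonNeg∧nonZero⇒pos b {{nonNegative 0≤b}}
    1/b>0 : Positive (1/ b)
    1/b>0 = 1/pos⇒pos b

[]-nonNeg : ∀ b → 0ℚ ≤ [ b ]
[]-nonNeg true  = nonNegative⁻¹ 1ℚ
[]-nonNeg false = ≤-refl

ext-nonNeg : ∀ {k} {v : Fin k → ℚ} → (∀ i → 0ℚ ≤ v i) → ∀ i → 0ℚ ≤ ext 0ℚ v i
ext-nonNeg 0≤v zero    = ≤-refl
ext-nonNeg 0≤v (suc i) = 0≤v i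

ext-zeroPrice : ∀ {k} (i : Fin (suc k)) → ext 0ℚ zeroPrice i ≡ 0ℚ
ext-zeroPrice zero    = refl
ext-zeroPrice (suc i) = refl

module _ {n m : ℕ} (u : Fin (suc n) → Fin (suc m) → ℚ) (x : Fin n → Bool) (y : Fin m → Bool) where

  private
    weight : Fin (suc n) → Fin (suc m) → ℚ
    weight i j = u i j * [ ext true x i ] * [ ext true y j ]

    denominator : ℚ
    denominator = sumFin λ i → sumFin (weight i)

    term : (Fin n → ℚ) → (Fin m → ℚ) → Fin (suc n) → Fin (suc m) → ℚ
    term p q i j = weight i j * (ext 0ℚ p i + ext 0ℚ q j)

    numerator : (Fin n → ℚ) → (Fin m → ℚ) → ℚ
    numerator p q = sumFin λ i → sumFin (term p q i)

  revenue-split : (p : Fin n → ℚ) (q : Fin m → ℚ) →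
                  revenue p q u x y ≡ revenue p zeroPrice u x y + revenue zeroPrice q u x y
  revenue-split p q =
    trans (cong (_/? denominator) numerator-split) (/?-distribʳ-+ _ _ denominator)
    where
    open ≡-Reasoning
    term-split : ∀ i j → term p q i j ≡ term p zeroPrice i j + term zeroPrice q i j
    term-split i j = begin
      w * (P + Q)     ≡⟨ *-distribˡ-+ w P Q ⟩
      w * P + w * Q   ≡⟨ cong₂ (λ a b → w * a + w * b) P+0≡P 0+Q≡Q ⟨
      w * (P + ext 0ℚ zeroPrice j) + w * (ext 0ℚ zeroPrice i + Q) ∎
      where
      w = weight i j
      P = ext 0ℚ p i
      Q = ext 0ℚ q j
      P+0≡P : P + ext 0ℚ zeroPrice j ≡ P
      P+0≡P = trans (cong (P +_) (ext-zeroPrice j)) (+-identityʳ P)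
      0+Q≡Q : ext 0ℚ zeroPrice i + Q ≡ Q
      0+Q≡Q = trans (cong (_+ Q) (ext-zeroPrice i)) (+-identityˡ Q)
    numerator-split : numerator p q ≡ numerator p zeroPrice + numerator zeroPrice q
    numerator-split =
      sumFin-split (λ i → sumFin (term p zeroPrice i)) (λ i → sumFin (term zeroPrice q i)) λ i →
        sumFin-split (term p zeroPrice i) (term zeroPrice q i) (term-split i)

  module _ (0≤u : ∀ i j → 0ℚ ≤ u i j) where

    revenue-nonNeg : ∀ {p q} → (∀ i → 0ℚ ≤ p i) → (∀ j → 0ℚ ≤ q j) → 0ℚ ≤ revenue p q u x y
    revenue-nonNeg 0≤p 0≤q = /?-nonNeg
      (sumFin-nonNeg λ i → sumFin-nonNeg λ j →
        0≤* (0≤weight i j) (0≤+ (ext-nonNeg 0≤p i) (ext-nonNeg 0≤q j)))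
      (sumFin-nonNeg λ i → sumFin-nonNeg λ j → 0≤weight i j)
      where
      0≤weight : ∀ i j → 0ℚ ≤ weight i j
      0≤weight i j = 0≤* (0≤* (0≤u i j) ([]-nonNeg (ext true x i))) ([]-nonNeg (ext true y j))

    revenue-p≤revenue : ∀ p q → (∀ j → 0ℚ ≤ q j) →
                        revenue p zeroPrice u x y ≤ revenue p q u x y
    revenue-p≤revenue p q 0≤q = ≤-trans (p≤p+q (revenue-nonNeg (λ _ → ≤-refl) 0≤q))
                                            (≤-reflexive (sym (revenue-split p q)))

    revenue-q≤revenue : ∀ p q → (∀ i → 0ℚ ≤ p i) →
                        revenue zeroPrice q u x y ≤ revenue p q u x y
    revenue-q≤revenue p q 0≤p = ≤-trans (q≤p+q (revenue-nonNeg 0≤p (λ _ → ≤-refl)))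
                                            (≤-reflexive (sym (revenue-split p q)))

module _ {n m : ℕ} {f : (Fin n → Bool) → (Fin m → Bool) → ℚ} where

  optimalValue≤solution : ∀ {v} → IsOptimalValue f v →
                          ∀ x y → IsOptimalSolution f x y → v ≤ f x y
  optimalValue≤solution ((x* , y* , f*≡v) , _) x y optimal =
    ≤-trans (≤-reflexive (sym f*≡v)) (optimal x* y*)

  optimalValue-subadditive : ∀ {g h : (Fin n → Bool) → (Fin m → Bool) → ℚ} {v a b} →
                             (∀ x y → f x y ≡ g x y + h x y) →
                             IsOptimalValue f v → IsOptimalValue g a → IsOptimalValue h b → v ≤ a + b
  optimalValue-subadditive {g = g} {h} {v} {a} {b} f≡g+h ((x* , y* , f*≡v) , _) (_ , g≤a) (_ , h≤b) =
    begin
      v                 ≡⟨ f*≡v ⟨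
      f x* y*           ≡⟨ f≡g+h x* y* ⟩
      g x* y* + h x* y* ≤⟨ +-mono-≤ (g≤a x* y*) (h≤b x* y*) ⟩
      a + b             ∎
    where open ≤-Reasoning

theorem2 : (n m : ℕ) (p : Fin n → ℚ) (q : Fin m → ℚ)
           (u : Fin (suc n) → Fin (suc m) → ℚ) →
           (∀ i → 0ℚ ≤ p i) → (∀ j → 0ℚ ≤ q j) →
           (∀ i j → 0ℚ ≤ u i j) → u zero zero ≡ 1ℚ →
           (πstar πp πq : ℚ) →
           IsOptimalValue (revenue p q u) πstar →
           IsOptimalValue (revenue p zeroPrice u) πp →
           IsOptimalValue (revenue zeroPrice q u) πq →
           (xA : Fin n → Bool) (yA : Fin m → Bool) →
           (πq ≤ πp → IsOptimalSolution (revenue p zeroPrice u) xA yA) →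
           (¬ (πq ≤ πp) → IsOptimalSolution (revenue zeroPrice q u) xA yA) →
           ½ * πstar ≤ revenue p q u xA yA
theorem2 n m p q u 0≤p 0≤q 0≤u _ πstar πp πq optimal optimalᵖ optimalᵠ xA yA aroᵖ aroᵠ =
  ½*-≤ (≤-trans πstar≤πp+πq (uncurry +-mono-≤ (bothBelowARO (πq ≤? πp))))
  where
  πᴬ = revenue p q u xA yA
  πstar≤πp+πq : πstar ≤ πp + πq
  πstar≤πp+πq = optimalValue-subadditive (λ x y → revenue-split u x y p q) optimal optimalᵖ optimalᵠ
  bothBelowARO : Dec (πq ≤ πp) → πp ≤ πᴬ × πq ≤ πᴬ
  bothBelowARO (yes πq≤πp) = πp≤πᴬ , ≤-trans πq≤πp πp≤πᴬ
    where
    πp≤πᴬ = ≤-trans (optimalValue≤solution optimalᵖ xA yA (aroᵖ πq≤πp))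
                    (revenue-p≤revenue u xA yA 0≤u p q 0≤q)
  bothBelowARO (no πq≰πp) = ≤-trans (<⇒≤ (≰⇒> πq≰πp)) πq≤πᴬ , πq≤πᴬ
    where
    πq≤πᴬ = ≤-trans (optimalValue≤solution optimalᵠ xA yA (aroᵠ πq≰πp))
                    (revenue-q≤revenue u xA yA 0≤u p q 0≤p)
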